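{- Let $G$ be a graph with two vertices $u$ and $u'$ such that $u$ has exactly one neighbor in $G-\{u'\}$, denoted $v$, and $u'$ has exactly one neighbor in $G$, which is either $u$ or $v$. Then $b^A_g(G)\ge b^A_g(G-\{u,u'\})$ and $b^I_g(G)\ge b^I_g(G-\{u,u'\})$.
   Context: The balance game on a finite simple graph $G$ is played by two players, Admirable (A) and Impish (I), who alternately select a not-yet-labeled vertex of $G$ until all vertices are labeled; Admirable labels each vertex she selects by $0$ and Impish labels each vertex he selects by $1$. Each edge receives the sum modulo $2$ of the labels of its endpoints. Let $e_0$ and $e_1$ be the numbers of edges labeled $0$ and $1$ at the end; the discrepancy is $d=e_1-e_0$. Admirable tries to minimize $d$ and Impish tries to maximize $d$. $b^A_g(G)$ is the value of $d$ under optimal play of both players when Admirable moves first, and $b^I_g(G)$ is the value under optimal play when Impish moves first. -}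

module Defs where

open import Data.Bool using (Bool; true; false; if_then_else_; _∧_; _xor_)
open import Data.Maybe using (Maybe; just; nothing; is-nothing; fromMaybe)
open import Data.Nat using (ℕ; zero; suc)
open import Data.Fin using (Fin; punchIn; toℕ; _≟_)
open import Data.Nat using (_<ᵇ_)
open import Data.List using (List; []; _∷_; allFin; filterᵇ; map; foldr; concatMap)
open import Data.Integer using (ℤ; +_; -_; _+_; _⊓_; _⊔_)
open import Relation.Binary.PropositionalEquality using (_≡_)
open import Relation.Nullary.Decidable using (⌊_⌋)

record SimpleGraph (n : ℕ) : Set where
  field
    adj    : Fin n → Fin n → Bool
    sym    : ∀ i j → adj i j ≡ adj j i
    irrefl : ∀ i → adj i i ≡ false
open SimpleGraph public

deleteVertex : ∀ {n} → SimpleGraph (suc n) → Fin (suc n) → SimpleGraph n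
deleteVertex G u = record
  { adj    = λ i j → adj G (punchIn u i) (punchIn u j)
  ; sym    = λ i j → sym G (punchIn u i) (punchIn u j)
  ; irrefl = λ i → irrefl G (punchIn u i)
  }

data Player : Set where
  Admirable Impish : Player

other : Player → Player
other Admirable = Impish
other Impish    = Admirable

-- Admirable labels by 0 (false), Impish by 1 (true).
label : Player → Bool
label Admirable = false
label Impish    = true

Labelling : ℕ → Set
Labelling n = Fin n → Maybe Bool

emptyLabelling : ∀ {n} → Labelling n
emptyLabelling _ = nothing

update : ∀ {n} → Labelling n → Fin n → Bool → Labelling n
update σ v b w = if ⌊ w ≟ v ⌋ then just b else σ w

unlabelled : ∀ {n} → Labelling n → List (Fin n)
unlabelled {n} σ = filterᵇ (λ v → is-nothing (σ v)) (allFin n)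

sumℤ : List ℤ → ℤ
sumℤ = foldr _+_ (+ 0)

-- Contribution of the (unordered) pair {i,j}, counted once via toℕ i < toℕ j:
-- +1 if it is an edge labelled 1, -1 if it is an edge labelled 0, 0 otherwise.
-- (At the end of the game every vertex is labelled, so fromMaybe is never used
-- on an unlabelled vertex.)
edgeValue : ∀ {n} → SimpleGraph n → Labelling n → Fin n → Fin n → ℤ
edgeValue G σ i j =
  if adj G i j ∧ (toℕ i <ᵇ toℕ j)
  then (if fromMaybe false (σ i) xor fromMaybe false (σ j) then + 1 else - (+ 1))
  else + 0

discrepancy : ∀ {n} → SimpleGraph n → Labelling n → ℤ
discrepancy {n} G σ =
  sumℤ (concatMap (λ i → map (λ j → edgeValue G σ i j) (allFin n)) (allFin n))

optimum : Player → ℤ → List ℤ → ℤ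
optimum Admirable x xs = foldr _⊓_ x xs
optimum Impish    x xs = foldr _⊔_ x xs

-- Value of the game under optimal play, with player p to move from labelling σ,
-- with at most k further moves (k = n from the start suffices).
gameValue : ∀ {n} → SimpleGraph n → ℕ → Player → Labelling n → ℤ
gameValue G zero    p σ = discrepancy G σ
gameValue G (suc k) p σ with unlabelled σ
... | []     = discrepancy G σ
... | v ∷ vs = optimum p (next v) (map next vs)
  where
  next : _ → ℤ
  next w = gameValue G k (other p) (update σ w (label p))

bA : ∀ {n} → SimpleGraph n → ℤ
bA {n} G = gameValue G n Admirable emptyLabelling

bI : ∀ {n} → SimpleGraph n → ℤ
bI {n} G = gameValue G n Impish emptyLabelling

-- Impish plays on G by following an optimal strategy for G' = G - {u, u'} on the common
-- vertices, treating Admirable's moves there as moves of G'; whenever Admirable labels one of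
-- u, u', Impish labels the other one oppositely (if Admirable never touches the pair, Impish
-- opens it once G' is full, and Admirable is then forced onto the partner). At the end u and u'
-- carry opposite labels and the rest of the labelling is a play of G'. The edges of G outside G'
-- are uv together with uu' (if x = u) or with u'v (if x = v): in the first case uu' is labelled 1
-- and outweighs uv, in the second exactly one of uv, u'v is labelled 1. So the discrepancy on G
-- is at least the one on G'.
module Submission where

open import Defs renaming (sym to adj-sym)
open import Data.Bool using (Bool; true; false; not; if_then_else_; _xor_; T)
open import Data.Bool.Properties using (xor-comm; ¬-not; T?)
open import Data.Empty using (⊥-elim)
open import Data.Fin using (Fin; zero; suc; punchIn; punchOut; toℕ; _≟_)
open import Data.Fin.Properties
  using (punchInᵢ≢i; punchIn-injective; punchIn-punchOut; toℕ-injective)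
open import Data.Integer using (ℤ; +_; -_; _+_; _⊓_; _⊔_; _≤_; _≥_; +≤+)
import Data.Integer.Properties as ℤ
open import Data.Integer.Solver using (module +-*-Solver)
open import Data.List using (List; []; _∷_; _++_; map; foldr; concatMap; tabulate; allFin)
open import Data.List.Properties using (map-tabulate; filter-none)
open import Data.List.Membership.Propositional using (_∈_)
open import Data.List.Membership.Propositional.Properties
  using (∈-allFin; ∈-map⁺; ∈-filter⁺; ∈-filter⁻)
open import Data.List.Relation.Unary.All as All using (All; []; _∷_)
open import Data.List.Relation.Unary.All.Properties using (map⁺; tabulate⁺)
open import Data.List.Relation.Unary.Any using (here; there)
open import Data.List.Relation.Unary.Any.Properties using (¬Any[])
open import Data.Maybe using (Maybe; just; nothing; is-nothing; fromMaybe)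
open import Data.Nat as ℕ using (ℕ; zero; suc; z≤n; _<ᵇ_)
import Data.Nat.Properties as ℕ
open import Data.Product using (_×_; _,_; ∃; proj₂)
open import Data.Sum using (_⊎_; inj₁; inj₂; [_,_]′)
open import Data.Unit using (tt)
open import Function using (_∘_)
open import Relation.Nullary using (yes; no)
open import Relation.Binary.PropositionalEquality
  using (_≡_; _≢_; _≗_; refl; sym; trans; cong; cong₂; subst; module ≡-Reasoning)

import Algebra.Properties.CommutativeMonoid.Sum as Sum
open Sum ℤ.+-0-commutativeMonoid
  using (sum; sum-syntax; sum-remove; ∑-distrib-+; sum-cong-≗; sum-replicate-zero)
module ℕΣ = Sum ℕ.+-0-commutativeMonoid

∑-single : ∀ {n} (f : Fin n → ℤ) i₀ → (∀ i → i ≢ i₀ → f i ≡ + 0) → ∑[ i < n ] f i ≡ f i₀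
∑-single {suc n} f i₀ f≡0 = begin
  sum f                        ≡⟨ sum-remove {i = i₀} f ⟩
  f i₀ + sum (f ∘ punchIn i₀)  ≡⟨ cong (λ z → f i₀ + z) rest≡0 ⟩
  f i₀ + + 0                   ≡⟨ ℤ.+-identityʳ (f i₀) ⟩
  f i₀                         ∎
  where
  open ≡-Reasoning
  rest≡0 : sum (f ∘ punchIn i₀) ≡ + 0
  rest≡0 = trans (sum-cong-≗ (λ j → f≡0 (punchIn i₀ j) (punchInᵢ≢i i₀ j))) (sum-replicate-zero n)

sumℤ-++ : ∀ xs ys → sumℤ (xs ++ ys) ≡ sumℤ xs + sumℤ ys
sumℤ-++ []       ys = sym (ℤ.+-identityˡ (sumℤ ys))
sumℤ-++ (x ∷ xs) ys =
  trans (cong (λ z → x + z) (sumℤ-++ xs ys)) (sym (ℤ.+-assoc x (sumℤ xs) (sumℤ ys)))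

sumℤ-concatMap : ∀ {A : Set} (g : A → List ℤ) xs →
                 sumℤ (concatMap g xs) ≡ sumℤ (map (sumℤ ∘ g) xs)
sumℤ-concatMap g []       = refl
sumℤ-concatMap g (x ∷ xs) =
  trans (sumℤ-++ (g x) (concatMap g xs)) (cong (λ z → sumℤ (g x) + z) (sumℤ-concatMap g xs))

sumℤ-tabulate : ∀ {n} (f : Fin n → ℤ) → sumℤ (tabulate f) ≡ sum f
sumℤ-tabulate {zero}  f = refl
sumℤ-tabulate {suc n} f = cong (λ z → f zero + z) (sumℤ-tabulate (f ∘ suc))

sumℤ-allFin : ∀ {n} (f : Fin n → ℤ) → sumℤ (map f (allFin n)) ≡ sum f
sumℤ-allFin f = trans (cong sumℤ (map-tabulate (λ i → i) f)) (sumℤ-tabulate f)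

discrepancy-∑ : ∀ {n} (G : SimpleGraph n) σ →
                discrepancy G σ ≡ ∑[ i < n ] ∑[ j < n ] edgeValue G σ i j
discrepancy-∑ {n} G σ = begin
  discrepancy G σ                          ≡⟨ sumℤ-concatMap row (allFin n) ⟩
  sumℤ (map (sumℤ ∘ row) (allFin n))       ≡⟨ sumℤ-allFin (sumℤ ∘ row) ⟩
  sum (sumℤ ∘ row)                         ≡⟨ sum-cong-≗ (λ i → sumℤ-allFin (edgeValue G σ i)) ⟩
  ∑[ i < n ] ∑[ j < n ] edgeValue G σ i j  ∎
  where
  open ≡-Reasoning
  row : Fin n → List ℤ
  row i = map (edgeValue G σ i) (allFin n)

discrepancy-cong : ∀ {n} (G : SimpleGraph n) {σ τ} → σ ≗ τ → discrepancy G σ ≡ discrepancy G τ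
discrepancy-cong {n} G {σ} {τ} σ≗τ = begin
  discrepancy G σ                          ≡⟨ discrepancy-∑ G σ ⟩
  ∑[ i < n ] ∑[ j < n ] edgeValue G σ i j  ≡⟨ sum-cong-≗ (λ i → sum-cong-≗ (edgeValue-cong i)) ⟩
  ∑[ i < n ] ∑[ j < n ] edgeValue G τ i j  ≡⟨ discrepancy-∑ G τ ⟨
  discrepancy G τ                          ∎
  where
  open ≡-Reasoning
  edgeValue-cong : ∀ i j → edgeValue G σ i j ≡ edgeValue G τ i j
  edgeValue-cong i j rewrite σ≗τ i | σ≗τ j = refl

sign : Bool → ℤ
sign b = if b then + 1 else - (+ 1)

labelOf : ∀ {n} → Labelling n → Fin n → Bool
labelOf σ i = fromMaybe false (σ i)

edgeSign : ∀ {n} → SimpleGraph n → Labelling n → Fin n → Fin n → ℤ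
edgeSign G σ a b = if adj G a b then sign (labelOf σ a xor labelOf σ b) else + 0

edgeSign-nonadj : ∀ {n} (G : SimpleGraph n) σ {a b} → adj G a b ≡ false → edgeSign G σ a b ≡ + 0
edgeSign-nonadj G σ a≁b rewrite a≁b = refl

edgeValue-diag : ∀ {n} (G : SimpleGraph n) σ a → edgeValue G σ a a ≡ + 0
edgeValue-diag G σ a rewrite irrefl G a = refl

<ᵇ-either : ∀ m n → m ≢ n →
            ((m <ᵇ n) ≡ true × (n <ᵇ m) ≡ false) ⊎ ((m <ᵇ n) ≡ false × (n <ᵇ m) ≡ true)
<ᵇ-either zero    zero    m≢n = ⊥-elim (m≢n refl)
<ᵇ-either zero    (suc n) _   = inj₁ (refl , refl)
<ᵇ-either (suc m) zero    _   = inj₂ (refl , refl)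
<ᵇ-either (suc m) (suc n) m≢n = <ᵇ-either m n (m≢n ∘ cong suc)

edgeValue-pair : ∀ {n} (G : SimpleGraph n) σ {a b} → a ≢ b →
                 edgeValue G σ a b + edgeValue G σ b a ≡ edgeSign G σ a b
edgeValue-pair G σ {a} {b} a≢b
  rewrite adj-sym G b a | xor-comm (labelOf σ b) (labelOf σ a) with adj G a b
... | false = refl
... | true with <ᵇ-either (toℕ a) (toℕ b) (a≢b ∘ toℕ-injective)
...   | inj₁ (a<b , b≮a) rewrite a<b | b≮a = ℤ.+-identityʳ _
...   | inj₂ (a≮b , b<a) rewrite a≮b | b<a = ℤ.+-identityˡ _

toℕ-punchIn-<ᵇ : ∀ {n} (a : Fin (suc n)) i j →
                 (toℕ (punchIn a i) <ᵇ toℕ (punchIn a j)) ≡ (toℕ i <ᵇ toℕ j)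
toℕ-punchIn-<ᵇ zero    i       j       = refl
toℕ-punchIn-<ᵇ (suc a) zero    zero    = refl
toℕ-punchIn-<ᵇ (suc a) zero    (suc j) = refl
toℕ-punchIn-<ᵇ (suc a) (suc i) zero    = refl
toℕ-punchIn-<ᵇ (suc a) (suc i) (suc j) = toℕ-punchIn-<ᵇ a i j

edgeValue-deleteVertex : ∀ {n} (G : SimpleGraph (suc n)) σ a i j →
  edgeValue G σ (punchIn a i) (punchIn a j) ≡ edgeValue (deleteVertex G a) (σ ∘ punchIn a) i j
edgeValue-deleteVertex G σ a i j rewrite toℕ-punchIn-<ᵇ a i j = refl

discrepancy-deleteVertex : ∀ {n} (G : SimpleGraph (suc n)) σ a →
  discrepancy G σ ≡
  ∑[ j < n ] edgeSign G σ a (punchIn a j) + discrepancy (deleteVertex G a) (σ ∘ punchIn a)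
discrepancy-deleteVertex {n} G σ a = begin
  discrepancy G σ
    ≡⟨ discrepancy-∑ G σ ⟩
  ∑[ i < suc n ] ∑[ j < suc n ] F i j
    ≡⟨ sum-cong-≗ (λ i → sum-remove {i = a} (F i)) ⟩
  ∑[ i < suc n ] (F i a + ∑[ j < n ] F i (pa j))
    ≡⟨ ∑-distrib-+ (λ i → F i a) (λ i → ∑[ j < n ] F i (pa j)) ⟩
  ∑[ i < suc n ] F i a + ∑[ i < suc n ] ∑[ j < n ] F i (pa j)
    ≡⟨ cong₂ _+_ (sum-remove {i = a} (λ i → F i a))
                 (sum-remove {i = a} (λ i → ∑[ j < n ] F i (pa j))) ⟩
  (F a a + Into) + (Out + Rest)
    ≡⟨ cong (λ z → (z + Into) + (Out + Rest)) (edgeValue-diag G σ a) ⟩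
  (+ 0 + Into) + (Out + Rest)
    ≡⟨ solve 3 (λ i o r → (con (+ 0) :+ i) :+ (o :+ r) := (o :+ i) :+ r) refl Into Out Rest ⟩
  (Out + Into) + Rest
    ≡⟨ cong₂ _+_ (∑-distrib-+ (λ j → F a (pa j)) (λ j → F (pa j) a)) Rest≡ ⟨
  ∑[ j < n ] (F a (pa j) + F (pa j) a) + discrepancy G-a (σ ∘ pa)
    ≡⟨ cong (_+ discrepancy G-a (σ ∘ pa))
            (sum-cong-≗ (λ j → edgeValue-pair G σ (punchInᵢ≢i a j ∘ sym))) ⟩
  ∑[ j < n ] edgeSign G σ a (pa j) + discrepancy G-a (σ ∘ pa)
    ∎
  where
  open ≡-Reasoning
  open +-*-Solver
  F : Fin (suc n) → Fin (suc n) → ℤ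
  F = edgeValue G σ
  pa : Fin n → Fin (suc n)
  pa = punchIn a
  G-a : SimpleGraph n
  G-a = deleteVertex G a
  Into Out Rest : ℤ
  Into = ∑[ i < n ] F (pa i) a
  Out  = ∑[ j < n ] F a (pa j)
  Rest = ∑[ i < n ] ∑[ j < n ] F (pa i) (pa j)
  Rest≡ : discrepancy G-a (σ ∘ pa) ≡ Rest
  Rest≡ = trans (discrepancy-∑ G-a (σ ∘ pa))
                (sum-cong-≗ (λ i → sum-cong-≗ (sym ∘ edgeValue-deleteVertex G σ a i)))

update-≡ : ∀ {n} (σ : Labelling n) w b → update σ w b w ≡ just b
update-≡ σ w b with w ≟ w
... | yes _   = refl
... | no w≢w = ⊥-elim (w≢w refl)

update-≢ : ∀ {n} (σ : Labelling n) {w} b {y} → y ≢ w → update σ w b y ≡ σ y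
update-≢ σ {w} b {y} y≢w with y ≟ w
... | yes y≡w = ⊥-elim (y≢w y≡w)
... | no _    = refl

isFree : Maybe Bool → ℕ
isFree nothing  = 1
isFree (just _) = 0

#unlabelled : ∀ {n} → Labelling n → ℕ
#unlabelled σ = ℕΣ.sum (isFree ∘ σ)

#unlabelled-empty : ∀ n → #unlabelled (emptyLabelling {n}) ≡ n
#unlabelled-empty zero    = refl
#unlabelled-empty (suc n) = cong suc (#unlabelled-empty n)

#unlabelled-update : ∀ {n} {σ : Labelling n} {w} b → σ w ≡ nothing →
                     #unlabelled σ ≡ suc (#unlabelled (update σ w b))
#unlabelled-update {suc n} {σ} {w} b w-free = begin
  #unlabelled σ
    ≡⟨ ℕΣ.sum-remove {i = w} (isFree ∘ σ) ⟩
  isFree (σ w) ℕ.+ ℕΣ.sum (isFree ∘ σ ∘ punchIn w)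
    ≡⟨ cong₂ ℕ._+_ (cong isFree w-free) rest≡ ⟩
  suc rest
    ≡⟨ cong (λ l → suc (isFree l ℕ.+ rest)) (update-≡ σ w b) ⟨
  suc (isFree (σ' w) ℕ.+ rest)
    ≡⟨ cong suc (ℕΣ.sum-remove {i = w} (isFree ∘ σ')) ⟨
  suc (#unlabelled σ')
    ∎
  where
  open ≡-Reasoning
  σ' : Labelling (suc n)
  σ' = update σ w b
  rest : ℕ
  rest = ℕΣ.sum (isFree ∘ σ' ∘ punchIn w)
  rest≡ : ℕΣ.sum (isFree ∘ σ ∘ punchIn w) ≡ rest
  rest≡ = ℕΣ.sum-cong-≗ (λ j → cong isFree (sym (update-≢ σ b (punchInᵢ≢i w j))))

Complete : ∀ {n} → Labelling n → Set
Complete σ = ∀ w → σ w ≢ nothing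

no-budget-complete : ∀ {n} (σ : Labelling n) → #unlabelled σ ℕ.≤ 0 → Complete σ
no-budget-complete σ bound w w-free
  with () ← subst (ℕ._≤ 0) (#unlabelled-update {σ = σ} false w-free) bound

budget-step : ∀ {n k} (σ : Labelling n) {w} b → #unlabelled σ ℕ.≤ suc k → σ w ≡ nothing →
              #unlabelled (update σ w b) ℕ.≤ k
budget-step {k = k} σ b bound w-free =
  ℕ.≤-pred (subst (ℕ._≤ suc k) (#unlabelled-update {σ = σ} b w-free) bound)

T-is-nothing : ∀ {l : Maybe Bool} → T (is-nothing l) → l ≡ nothing
T-is-nothing {nothing} _ = refl

module _ {n} {σ : Labelling n} where

  ∈-unlabelled⁺ : ∀ {w} → σ w ≡ nothing → w ∈ unlabelled σ
  ∈-unlabelled⁺ {w} w-free =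
    ∈-filter⁺ (T? ∘ is-nothing ∘ σ) (∈-allFin w) (subst (T ∘ is-nothing) (sym w-free) tt)

  ∈-unlabelled⁻ : ∀ {w} → w ∈ unlabelled σ → σ w ≡ nothing
  ∈-unlabelled⁻ w∈ = T-is-nothing (proj₂ (∈-filter⁻ (T? ∘ is-nothing ∘ σ) {xs = allFin n} w∈))

  unlabelled-complete : Complete σ → unlabelled σ ≡ []
  unlabelled-complete σ-complete =
    filter-none (T? ∘ is-nothing ∘ σ) (tabulate⁺ (λ w → σ-complete w ∘ T-is-nothing))

  complete? : Complete σ ⊎ ∃ λ w → σ w ≡ nothing
  complete? with unlabelled σ in eq
  ... | []    = inj₁ λ w w-free → ¬Any[] (subst (w ∈_) eq (∈-unlabelled⁺ w-free))
  ... | w ∷ _ = inj₂ (w , ∈-unlabelled⁻ (subst (w ∈_) (sym eq) (here refl)))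

⊔-foldr-upper : ∀ {x} x₀ xs → x ∈ x₀ ∷ xs → x ≤ foldr _⊔_ x₀ xs
⊔-foldr-upper x₀ []       (here refl)         = ℤ.≤-refl
⊔-foldr-upper x₀ (y ∷ ys) (here refl)         =
  ℤ.≤-trans (⊔-foldr-upper x₀ ys (here refl)) (ℤ.i≤j⊔i y _)
⊔-foldr-upper x₀ (y ∷ ys) (there (here refl)) = ℤ.i≤i⊔j y _
⊔-foldr-upper x₀ (y ∷ ys) (there (there x∈))  =
  ℤ.≤-trans (⊔-foldr-upper x₀ ys (there x∈)) (ℤ.i≤j⊔i y _)

⊔-foldr-least : ∀ {c} x₀ xs → All (_≤ c) (x₀ ∷ xs) → foldr _⊔_ x₀ xs ≤ c
⊔-foldr-least x₀ []       (x₀≤c ∷ [])          = x₀≤c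
⊔-foldr-least x₀ (y ∷ ys) (x₀≤c ∷ y≤c ∷ ys≤c) =
  ℤ.⊔-lub y≤c (⊔-foldr-least x₀ ys (x₀≤c ∷ ys≤c))

⊓-foldr-lower : ∀ {x} x₀ xs → x ∈ x₀ ∷ xs → foldr _⊓_ x₀ xs ≤ x
⊓-foldr-lower x₀ []       (here refl)         = ℤ.≤-refl
⊓-foldr-lower x₀ (y ∷ ys) (here refl)         =
  ℤ.≤-trans (ℤ.i⊓j≤j y _) (⊓-foldr-lower x₀ ys (here refl))
⊓-foldr-lower x₀ (y ∷ ys) (there (here refl)) = ℤ.i⊓j≤i y _
⊓-foldr-lower x₀ (y ∷ ys) (there (there x∈))  =
  ℤ.≤-trans (ℤ.i⊓j≤j y _) (⊓-foldr-lower x₀ ys (there x∈))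

⊓-foldr-greatest : ∀ {c} x₀ xs → All (c ≤_) (x₀ ∷ xs) → c ≤ foldr _⊓_ x₀ xs
⊓-foldr-greatest x₀ []       (c≤x₀ ∷ [])          = c≤x₀
⊓-foldr-greatest x₀ (y ∷ ys) (c≤x₀ ∷ c≤y ∷ c≤ys) =
  ℤ.⊓-glb c≤y (⊓-foldr-greatest x₀ ys (c≤x₀ ∷ c≤ys))

gameValue-complete : ∀ {n} (G : SimpleGraph n) k p {σ} → Complete σ →
                     gameValue G k p σ ≡ discrepancy G σ
gameValue-complete G zero    p σ-complete = refl
gameValue-complete G (suc k) p σ-complete rewrite unlabelled-complete σ-complete = refl

module _ {n} (G : SimpleGraph n) (k : ℕ) (σ : Labelling n) where

  valueAfter : Player → Fin n → ℤ
  valueAfter p w = gameValue G k (other p) (update σ w (label p))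

  private
    all-moves : ∀ {P : ℤ → Set} p → (∀ w → σ w ≡ nothing → P (valueAfter p w)) →
                ∀ {v vs} → unlabelled σ ≡ v ∷ vs → All P (valueAfter p v ∷ map (valueAfter p) vs)
    all-moves p bound eq =
      map⁺ (All.tabulate λ {w} w∈ → bound w (∈-unlabelled⁻ (subst (w ∈_) (sym eq) w∈)))

  Impish-≥-move : ∀ {w} → σ w ≡ nothing → valueAfter Impish w ≤ gameValue G (suc k) Impish σ
  Impish-≥-move w-free with unlabelled σ | ∈-unlabelled⁺ {σ = σ} w-free
  ... | v ∷ vs | w∈ = ⊔-foldr-upper _ _ (∈-map⁺ (valueAfter Impish) w∈)

  Impish-≤ : ∀ {w₀ c} → σ w₀ ≡ nothing → (∀ w → σ w ≡ nothing → valueAfter Impish w ≤ c) →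
             gameValue G (suc k) Impish σ ≤ c
  Impish-≤ w₀-free bound with unlabelled σ in eq | ∈-unlabelled⁺ {σ = σ} w₀-free
  ... | v ∷ vs | _ = ⊔-foldr-least _ _ (all-moves Impish bound eq)

  Admirable-≤-move : ∀ {w} → σ w ≡ nothing →
                     gameValue G (suc k) Admirable σ ≤ valueAfter Admirable w
  Admirable-≤-move w-free with unlabelled σ | ∈-unlabelled⁺ {σ = σ} w-free
  ... | v ∷ vs | w∈ = ⊓-foldr-lower _ _ (∈-map⁺ (valueAfter Admirable) w∈)

  Admirable-≥ : ∀ {w₀ c} → σ w₀ ≡ nothing → (∀ w → σ w ≡ nothing → c ≤ valueAfter Admirable w) →
                c ≤ gameValue G (suc k) Admirable σ
  Admirable-≥ w₀-free bound with unlabelled σ in eq | ∈-unlabelled⁺ {σ = σ} w₀-free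
  ... | v ∷ vs | _ = ⊓-foldr-greatest _ _ (all-moves Admirable bound eq)

module Pairing {m} (G : SimpleGraph (suc (suc m))) {u u' : Fin (suc (suc m))} (u≢u' : u ≢ u') where

  u″ : Fin (suc m)
  u″ = punchOut u≢u'

  G' : SimpleGraph m
  G' = deleteVertex (deleteVertex G u) u″

  embed : Fin m → Fin (suc (suc m))
  embed = punchIn u ∘ punchIn u″

  punchIn-u″ : punchIn u u″ ≡ u'
  punchIn-u″ = punchIn-punchOut u≢u'

  embed≢u : ∀ i → embed i ≢ u
  embed≢u i = punchInᵢ≢i u (punchIn u″ i)

  embed≢u' : ∀ i → embed i ≢ u'
  embed≢u' i eq = punchInᵢ≢i u″ i (punchIn-injective u _ _ (trans eq (sym punchIn-u″)))

  embed-injective : ∀ {i j} → embed i ≡ embed j → i ≡ j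
  embed-injective = punchIn-injective u″ _ _ ∘ punchIn-injective u _ _

  embed-onto : ∀ {w} → w ≢ u → w ≢ u' → ∃ λ i → embed i ≡ w
  embed-onto {w} w≢u w≢u' =
    punchOut u″≢j , trans (cong (punchIn u) (punchIn-punchOut u″≢j)) (punchIn-punchOut u≢w)
    where
    u≢w : u ≢ w
    u≢w = w≢u ∘ sym
    j : Fin (suc m)
    j = punchOut u≢w
    u″≢j : u″ ≢ j
    u″≢j u″≡j =
      w≢u' (trans (sym (punchIn-punchOut u≢w)) (trans (cong (punchIn u) (sym u″≡j)) punchIn-u″))

  vertex-cases : ∀ w → w ≡ u ⊎ w ≡ u' ⊎ ∃ λ i → embed i ≡ w
  vertex-cases w with w ≟ u | w ≟ u'
  ... | yes w≡u | _        = inj₁ w≡u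
  ... | no _    | yes w≡u' = inj₂ (inj₁ w≡u')
  ... | no w≢u  | no w≢u'  = inj₂ (inj₂ (embed-onto w≢u w≢u'))

  data Paired (σ : Labelling (suc (suc m))) : Set where
    both-free : σ u ≡ nothing → σ u' ≡ nothing → Paired σ
    opposite  : ∀ a → σ u ≡ just a → σ u' ≡ just (not a) → Paired σ

  partner-free : ∀ {σ} → Paired σ → σ u ≡ nothing → σ u' ≡ nothing
  partner-free (both-free _ u'-free) _      = u'-free
  partner-free (opposite a σu _)     u-free with () ← trans (sym σu) u-free

  partner-free' : ∀ {σ} → Paired σ → σ u' ≡ nothing → σ u ≡ nothing
  partner-free' (both-free u-free _) _       = u-free
  partner-free' (opposite a _ σu')   u'-free with () ← trans (sym σu') u'-free

  u'-free-after-u : ∀ {σ} b → Paired σ → σ u ≡ nothing → update σ u b u' ≡ nothing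
  u'-free-after-u {σ} b pσ u-free = trans (update-≢ σ b (u≢u' ∘ sym)) (partner-free pσ u-free)

  u-free-after-u' : ∀ {σ} b → Paired σ → σ u' ≡ nothing → update σ u' b u ≡ nothing
  u-free-after-u' {σ} b pσ u'-free = trans (update-≢ σ b u≢u') (partner-free' pσ u'-free)

  -- A position of the game on G reached by Impish's strategy, next to the mirrored position on G'.
  -- gameValue stops after k moves, so the budgets k, k' must cover the unlabelled vertices.
  record Coupled (k k' : ℕ) (σ : Labelling (suc (suc m))) (τ : Labelling m) : Set where
    field
      budget    : #unlabelled σ ℕ.≤ k
      budget'   : #unlabelled τ ℕ.≤ k'
      restricts : σ ∘ embed ≗ τ
      paired    : Paired σ

    free-embed : ∀ {i} → τ i ≡ nothing → σ (embed i) ≡ nothing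
    free-embed {i} τi-free = trans (restricts i) τi-free

    free-restrict : ∀ {i} → σ (embed i) ≡ nothing → τ i ≡ nothing
    free-restrict {i} σi-free = trans (sym (restricts i)) σi-free

  open Coupled

  out-of-moves : ∀ {k' σ τ} → Coupled 0 k' σ τ → Complete σ
  out-of-moves {σ = σ} c = no-budget-complete σ (budget c)

  out-of-moves' : ∀ {k σ τ} → Coupled k 0 σ τ → Complete τ
  out-of-moves' {τ = τ} c = no-budget-complete τ (budget' c)

  pair-needs-two-moves : ∀ {k' σ τ} → Coupled 1 k' σ τ → σ u ≢ nothing
  pair-needs-two-moves {σ = σ} c u-free =
    no-budget-complete (update σ u false) (budget-step σ false (budget c) u-free)
                       u' (u'-free-after-u false (paired c) u-free)

  extend-complete : ∀ {k k' σ τ a a'} → Coupled k k' σ τ → Complete τ →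
                    σ u ≡ just a → σ u' ≡ just a' → Complete σ
  extend-complete c τ-complete σu σu' w w-free with vertex-cases w
  ... | inj₁ refl              with () ← trans (sym σu) w-free
  ... | inj₂ (inj₁ refl)       with () ← trans (sym σu') w-free
  ... | inj₂ (inj₂ (i , refl)) = τ-complete i (free-restrict c w-free)

  mirror-move : ∀ {k k' σ τ i} b → Coupled (suc k) (suc k') σ τ → σ (embed i) ≡ nothing →
                Coupled k k' (update σ (embed i) b) (update τ i b)
  mirror-move {σ = σ} {τ} {i} b c free = record
    { budget    = budget-step σ b (budget c) free
    ; budget'   = budget-step τ b (budget' c) (free-restrict c free)
    ; restricts = restricts-update
    ; paired    = paired-update (paired c)
    }
    where
    restricts-update : update σ (embed i) b ∘ embed ≗ update τ i b
    restricts-update j with j ≟ i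
    ... | yes refl = update-≡ σ (embed i) b
    ... | no j≢i   = trans (update-≢ σ b (j≢i ∘ embed-injective)) (restricts c j)
    same-u : update σ (embed i) b u ≡ σ u
    same-u = update-≢ σ b (embed≢u i ∘ sym)
    same-u' : update σ (embed i) b u' ≡ σ u'
    same-u' = update-≢ σ b (embed≢u' i ∘ sym)
    paired-update : Paired σ → Paired (update σ (embed i) b)
    paired-update (both-free u-free u'-free) = both-free (trans same-u u-free) (trans same-u' u'-free)
    paired-update (opposite a σu σu')        = opposite a (trans same-u σu) (trans same-u' σu')

  private
    restricts-update-outside : ∀ σ {τ w} b → (∀ i → embed i ≢ w) → σ ∘ embed ≗ τ →
                               update σ w b ∘ embed ≗ τ
    restricts-update-outside σ b outside σ≗τ i = trans (update-≢ σ b (outside i)) (σ≗τ i)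

  pair-move : ∀ {k k' σ τ} a → Coupled (suc (suc k)) k' σ τ → σ u ≡ nothing →
              Coupled k k' (update (update σ u a) u' (not a)) τ
  pair-move {σ = σ} a c u-free = record
    { budget    = budget-step σ₁ (not a) (budget-step σ a (budget c) u-free)
                              (u'-free-after-u a (paired c) u-free)
    ; budget'   = budget' c
    ; restricts = restricts-update-outside σ₁ (not a) embed≢u'
                    (restricts-update-outside σ a embed≢u (restricts c))
    ; paired    = opposite a (trans (update-≢ σ₁ (not a) u≢u') (update-≡ σ u a))
                             (update-≡ σ₁ u' (not a))
    }
    where
    σ₁ : Labelling (suc (suc m))
    σ₁ = update σ u a

  pair-move' : ∀ {k k' σ τ} a → Coupled (suc (suc k)) k' σ τ → σ u' ≡ nothing →
               Coupled k k' (update (update σ u' (not a)) u a) τ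
  pair-move' {σ = σ} a c u'-free = record
    { budget    = budget-step σ₁ a (budget-step σ (not a) (budget c) u'-free)
                              (u-free-after-u' (not a) (paired c) u'-free)
    ; budget'   = budget' c
    ; restricts = restricts-update-outside σ₁ a embed≢u
                    (restricts-update-outside σ (not a) embed≢u' (restricts c))
    ; paired    = opposite a (update-≡ σ₁ u a)
                             (trans (update-≢ σ₁ a (u≢u' ∘ sym)) (update-≡ σ u' (not a)))
    }
    where
    σ₁ : Labelling (suc (suc m))
    σ₁ = update σ u' (not a)

  module _ (discrepancy-mono : ∀ σ a → σ u ≡ just a → σ u' ≡ just (not a) →
                               discrepancy G' (σ ∘ embed) ≤ discrepancy G σ) where

    at-completion : ∀ {k k'} p {σ τ} → Coupled k k' σ τ → Complete σ →
                    gameValue G' k' p τ ≤ gameValue G k p σ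
    at-completion p c σ-complete with paired c
    ... | both-free u-free _ = ⊥-elim (σ-complete u u-free)
    at-completion {k} {k'} p {σ} {τ} c σ-complete | opposite a σu σu' = begin
      gameValue G' k' p τ         ≡⟨ gameValue-complete G' k' p τ-complete ⟩
      discrepancy G' τ            ≡⟨ discrepancy-cong G' (restricts c) ⟨
      discrepancy G' (σ ∘ embed)  ≤⟨ discrepancy-mono σ a σu σu' ⟩
      discrepancy G σ             ≡⟨ gameValue-complete G k p σ-complete ⟨
      gameValue G k p σ           ∎
      where
      open ℤ.≤-Reasoning
      τ-complete : Complete τ
      τ-complete i τi-free = σ-complete (embed i) (free-embed c τi-free)

    mutual
      simulate : ∀ {k k'} p {σ τ} → Coupled k k' σ τ → gameValue G' k' p τ ≤ gameValue G k p σ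
      simulate Admirable {σ} c with complete? {σ = σ}
      ... | inj₁ σ-complete    = at-completion Admirable c σ-complete
      ... | inj₂ (_ , w-free) = Admirable-turn c w-free
      simulate Impish {τ = τ} c with complete? {σ = τ}
      ... | inj₁ τ-complete   = Impish-opens c τ-complete
      ... | inj₂ (_ , i-free) = Impish-turn c i-free

      Admirable-turn : ∀ {k k' σ τ w₀} → Coupled k k' σ τ → σ w₀ ≡ nothing →
                       gameValue G' k' Admirable τ ≤ gameValue G k Admirable σ
      Admirable-turn {zero} c w₀-free = ⊥-elim (out-of-moves c _ w₀-free)
      Admirable-turn {suc k} {k'} {σ} {τ} c w₀-free = Admirable-≥ G k σ w₀-free reply
        where
        reply : ∀ w → σ w ≡ nothing →
                gameValue G' k' Admirable τ ≤ gameValue G k Impish (update σ w false)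
        reply w w-free with vertex-cases w
        ... | inj₁ refl              = Impish-answers-u c w-free
        ... | inj₂ (inj₁ refl)       = Impish-answers-u' c w-free
        ... | inj₂ (inj₂ (i , refl)) = Impish-mirrors c w-free

      Impish-answers-u : ∀ {k k' σ τ} → Coupled (suc k) k' σ τ → σ u ≡ nothing →
                         gameValue G' k' Admirable τ ≤ gameValue G k Impish (update σ u false)
      Impish-answers-u {zero}              c u-free = ⊥-elim (pair-needs-two-moves c u-free)
      Impish-answers-u {suc k} {σ = σ} c u-free =
        ℤ.≤-trans (simulate Admirable (pair-move false c u-free))
                  (Impish-≥-move G k (update σ u false) (u'-free-after-u false (paired c) u-free))

      Impish-answers-u' : ∀ {k k' σ τ} → Coupled (suc k) k' σ τ → σ u' ≡ nothing →
                          gameValue G' k' Admirable τ ≤ gameValue G k Impish (update σ u' false)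
      Impish-answers-u' {zero} c u'-free =
        ⊥-elim (pair-needs-two-moves c (partner-free' (paired c) u'-free))
      Impish-answers-u' {suc k} {σ = σ} c u'-free =
        ℤ.≤-trans (simulate Admirable (pair-move' true c u'-free))
                  (Impish-≥-move G k (update σ u' false) (u-free-after-u' false (paired c) u'-free))

      Impish-mirrors : ∀ {k k' σ τ i} → Coupled (suc k) k' σ τ → σ (embed i) ≡ nothing →
                       gameValue G' k' Admirable τ ≤ gameValue G k Impish (update σ (embed i) false)
      Impish-mirrors {k' = zero}   c free = ⊥-elim (out-of-moves' c _ (free-restrict c free))
      Impish-mirrors {k' = suc k'} {τ = τ} c free =
        ℤ.≤-trans (Admirable-≤-move G' k' τ (free-restrict c free))
                  (simulate Impish (mirror-move false c free))

      Impish-turn : ∀ {k k' σ τ i₀} → Coupled k k' σ τ → τ i₀ ≡ nothing →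
                    gameValue G' k' Impish τ ≤ gameValue G k Impish σ
      Impish-turn {zero}           c i₀-free = ⊥-elim (out-of-moves c _ (free-embed c i₀-free))
      Impish-turn {suc k} {zero}   c i₀-free = ⊥-elim (out-of-moves' c _ i₀-free)
      Impish-turn {suc k} {suc k'} {σ} {τ} c i₀-free = Impish-≤ G' k' τ i₀-free λ i i-free →
        ℤ.≤-trans (simulate Admirable (mirror-move true c (free-embed c i-free)))
                  (Impish-≥-move G k σ (free-embed c i-free))

      Impish-opens : ∀ {k k' σ τ} → Coupled k k' σ τ → Complete τ →
                     gameValue G' k' Impish τ ≤ gameValue G k Impish σ
      Impish-opens c τ-complete with paired c
      ... | opposite a σu σu'  = at-completion Impish c (extend-complete c τ-complete σu σu')
      ... | both-free u-free _ = Impish-opens-pair c τ-complete u-free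

      Impish-opens-pair : ∀ {k k' σ τ} → Coupled k k' σ τ → Complete τ → σ u ≡ nothing →
                          gameValue G' k' Impish τ ≤ gameValue G k Impish σ
      Impish-opens-pair {zero}     c _ u-free = ⊥-elim (out-of-moves c u u-free)
      Impish-opens-pair {suc zero} c _ u-free = ⊥-elim (pair-needs-two-moves c u-free)
      Impish-opens-pair {suc (suc k)} {k'} {σ} {τ} c τ-complete u-free =
        ℤ.≤-trans (Admirable-≥ G k σ₁ (u'-free-after-u true (paired c) u-free) forced)
                  (Impish-≥-move G (suc k) σ u-free)
        where
        σ₁ : Labelling (suc (suc m))
        σ₁ = update σ u true
        only-u'-free : ∀ w → σ₁ w ≡ nothing → w ≡ u'
        only-u'-free w w-free with vertex-cases w
        ... | inj₁ refl with () ← trans (sym (update-≡ σ u true)) w-free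
        ... | inj₂ (inj₁ w≡u')       = w≡u'
        ... | inj₂ (inj₂ (i , refl)) =
          ⊥-elim (τ-complete i (free-restrict c (trans (sym (update-≢ σ true (embed≢u i))) w-free)))
        forced : ∀ w → σ₁ w ≡ nothing →
                 gameValue G' k' Impish τ ≤ gameValue G k Impish (update σ₁ w false)
        forced w w-free with only-u'-free w w-free
        ... | refl = simulate Impish (pair-move true c u-free)

    initial : Coupled (suc (suc m)) m emptyLabelling emptyLabelling
    initial = record
      { budget    = ℕ.≤-reflexive (#unlabelled-empty (suc (suc m)))
      ; budget'   = ℕ.≤-reflexive (#unlabelled-empty m)
      ; restricts = λ _ → refl
      ; paired    = both-free refl refl
      }

    bA-mono : bA G' ≤ bA G
    bA-mono = simulate Admirable initial

    bI-mono : bI G' ≤ bI G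
    bI-mono = simulate Impish initial

sign-xor-not+sign≥0 : ∀ a b → + 0 ≤ sign (a xor not a) + sign b
sign-xor-not+sign≥0 false false = +≤+ z≤n
sign-xor-not+sign≥0 false true  = +≤+ z≤n
sign-xor-not+sign≥0 true  false = +≤+ z≤n
sign-xor-not+sign≥0 true  true  = +≤+ z≤n

sign-xor+sign-not-xor≡0 : ∀ a c → sign (a xor c) + sign (not a xor c) ≡ + 0
sign-xor+sign-not-xor≡0 false false = refl
sign-xor+sign-not-xor≡0 false true  = refl
sign-xor+sign-not-xor≡0 true  false = refl
sign-xor+sign-not-xor≡0 true  true  = refl

module PendantPair {m} (G : SimpleGraph (suc (suc m))) {u u' v x : Fin (suc (suc m))}
  (u≢u' : u ≢ u') (v≢u' : v ≢ u') (u~v : adj G u v ≡ true)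
  (N[u] : ∀ w → w ≢ u' → adj G u w ≡ true → w ≡ v)
  (u'~x : adj G u' x ≡ true) (N[u'] : ∀ w → adj G u' w ≡ true → w ≡ x)
  (x≡u⊎v : x ≡ u ⊎ x ≡ v) where

  open Pairing G u≢u'

  v≢u : v ≢ u
  v≢u v≡u with () ← trans (sym (irrefl G u)) (subst (λ w → adj G u w ≡ true) v≡u u~v)

  gain : Labelling (suc (suc m)) → ℤ
  gain σ = (edgeSign G σ u u' + edgeSign G σ u v) + edgeSign G σ u' v

  ∑-edgeSign-embed-single : ∀ σ a → (∀ i → adj G a (embed i) ≡ true → embed i ≡ v) →
                            ∑[ i < m ] edgeSign G σ a (embed i) ≡ edgeSign G σ a v
  ∑-edgeSign-embed-single σ a only-v with embed-onto v≢u v≢u'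
  ... | i₀ , embed-i₀ = trans (∑-single _ i₀ vanish) (cong (edgeSign G σ a) embed-i₀)
    where
    vanish : ∀ i → i ≢ i₀ → edgeSign G σ a (embed i) ≡ + 0
    vanish i i≢i₀ = edgeSign-nonadj G σ (¬-not λ a~i →
      i≢i₀ (embed-injective (trans (only-v i a~i) (sym embed-i₀))))

  discrepancy-split : ∀ σ → discrepancy G σ ≡ gain σ + discrepancy G' (σ ∘ embed)
  discrepancy-split σ = begin
    discrepancy G σ
      ≡⟨ discrepancy-deleteVertex G σ u ⟩
    Star-u + discrepancy (deleteVertex G u) (σ ∘ punchIn u)
      ≡⟨ cong (λ d → Star-u + d) (discrepancy-deleteVertex (deleteVertex G u) (σ ∘ punchIn u) u″) ⟩
    Star-u + (∑[ i < m ] edgeSign G σ (punchIn u u″) (embed i) + D')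
      ≡⟨ cong₂ (λ s t → s + (t + D')) Star-u≡ Star-u'≡ ⟩
    (edgeSign G σ u u' + edgeSign G σ u v) + (edgeSign G σ u' v + D')
      ≡⟨ ℤ.+-assoc (edgeSign G σ u u' + edgeSign G σ u v) (edgeSign G σ u' v) D' ⟨
    gain σ + D'
      ∎
    where
    open ≡-Reasoning
    D' Star-u : ℤ
    D' = discrepancy G' (σ ∘ embed)
    Star-u = ∑[ j < suc m ] edgeSign G σ u (punchIn u j)
    Star-u≡ : Star-u ≡ edgeSign G σ u u' + edgeSign G σ u v
    Star-u≡ = trans (sum-remove {i = u″} (edgeSign G σ u ∘ punchIn u))
                    (cong₂ _+_ (cong (edgeSign G σ u) punchIn-u″)
                               (∑-edgeSign-embed-single σ u (λ i → N[u] (embed i) (embed≢u' i))))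
    only-v : ∀ i → adj G u' (embed i) ≡ true → embed i ≡ v
    only-v i u'~i = [ (λ x≡u → ⊥-elim (embed≢u i (trans i≡x x≡u))) , trans i≡x ]′ x≡u⊎v
      where
      i≡x : embed i ≡ x
      i≡x = N[u'] (embed i) u'~i
    Star-u'≡ : ∑[ i < m ] edgeSign G σ (punchIn u u″) (embed i) ≡ edgeSign G σ u' v
    Star-u'≡ = trans (cong (λ a → ∑[ i < m ] edgeSign G σ a (embed i)) punchIn-u″)
                     (∑-edgeSign-embed-single σ u' only-v)

  u~u' : x ≡ u → adj G u u' ≡ true
  u~u' x≡u = trans (adj-sym G u u') (subst (λ w → adj G u' w ≡ true) x≡u u'~x)

  u'≁v : x ≡ u → adj G u' v ≡ false
  u'≁v x≡u = ¬-not λ u'~v → v≢u (trans (N[u'] v u'~v) x≡u)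

  u≁u' : x ≡ v → adj G u u' ≡ false
  u≁u' x≡v = ¬-not λ u~u' → v≢u (sym (trans (N[u'] u (trans (adj-sym G u' u) u~u')) x≡v))

  u'~v : x ≡ v → adj G u' v ≡ true
  u'~v x≡v = subst (λ w → adj G u' w ≡ true) x≡v u'~x

  gain-nonneg : ∀ σ a → σ u ≡ just a → σ u' ≡ just (not a) → + 0 ≤ gain σ
  gain-nonneg σ a σu σu' = by-cases x≡u⊎v
    where
    by-cases : x ≡ u ⊎ x ≡ v → + 0 ≤ gain σ
    by-cases (inj₁ x≡u) rewrite u~u' x≡u | u'≁v x≡u | u~v | σu | σu'
      | ℤ.+-identityʳ (sign (a xor not a) + sign (a xor labelOf σ v)) =
      sign-xor-not+sign≥0 a _
    by-cases (inj₂ x≡v) rewrite u≁u' x≡v | u~v | u'~v x≡v | σu | σu'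
      | ℤ.+-identityˡ (sign (a xor labelOf σ v)) =
      ℤ.≤-reflexive (sym (sign-xor+sign-not-xor≡0 a (labelOf σ v)))

  discrepancy-mono : ∀ σ a → σ u ≡ just a → σ u' ≡ just (not a) →
                     discrepancy G' (σ ∘ embed) ≤ discrepancy G σ
  discrepancy-mono σ a σu σu' = begin
    D'               ≡⟨ ℤ.+-identityˡ D' ⟨
    + 0 + D'         ≤⟨ ℤ.+-monoˡ-≤ D' (gain-nonneg σ a σu σu') ⟩
    gain σ + D'      ≡⟨ discrepancy-split σ ⟨
    discrepancy G σ  ∎
    where
    open ℤ.≤-Reasoning
    D' : ℤ
    D' = discrepancy G' (σ ∘ embed)

lemma3p1 : ∀ {m : ℕ} (G : SimpleGraph (suc (suc m))) (u u' v x : Fin (suc (suc m)))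
  → (u≢u' : u ≢ u')
  → v ≢ u' → adj G u v ≡ true
  → (∀ w → w ≢ u' → adj G u w ≡ true → w ≡ v)
  → adj G u' x ≡ true
  → (∀ w → adj G u' w ≡ true → w ≡ x)
  → (x ≡ u ⊎ x ≡ v)
  → (bA G ≥ bA (deleteVertex (deleteVertex G u) (punchOut u≢u')))
    × (bI G ≥ bI (deleteVertex (deleteVertex G u) (punchOut u≢u')))
lemma3p1 G u u' v x u≢u' v≢u' u~v N[u] u'~x N[u'] x≡u⊎v =
  bA-mono discrepancy-mono , bI-mono discrepancy-mono
  where
  open Pairing G u≢u' using (bA-mono; bI-mono)
  open PendantPair G u≢u' v≢u' u~v N[u] u'~x N[u'] x≡u⊎v using (discrepancy-mono)
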